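{- Let $m\in\mathbb{N}$, $b,c\in\mathrm{R}_m$ and $n,k\in\mathbb{N}$. Then $b^n\bmod m$ and $b^k\bmod m$ both belong to $\mathrm{Orb}_m(c)$ if and only if $b^{(n,k)}\bmod m\in\mathrm{Orb}_m(c)$.
   Context: $\mathbb{N}=\{1,2,\dots\}$, $\mathbb{Z}_m=\{1,\dots,m\}$, $x\bmod m$ denotes the element of $\mathbb{Z}_m$ congruent to $x$, $(n,k)$ is the gcd. $\mathrm{E}_m=\{e\in\mathbb{Z}_m: e^2\equiv e\pmod m\}$. For $a\in\mathbb{Z}$, $|a|_m$ is the smallest $n\in\mathbb{N}$ with $a^n\bmod m\in\mathrm{E}_m$. $a\in\mathbb{Z}_m$ is regular if $a^{|a|_m+1}\equiv a\pmod m$; $\mathrm{R}_m$ is the set of regular residues. The orbit of $a\in\mathbb{Z}_m$ is $\mathrm{Orb}_m(a)=\{a^n\bmod m: 1\le n\le|a|_m\}$. -}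

module Defs where

open import Data.Nat using (ℕ; zero; suc; _+_; _*_; _^_; _≤_; _<_; NonZero)
open import Data.Nat.DivMod using (_%_)
open import Data.Product using (Σ; _×_; ∃; ∃-syntax)
open import Relation.Binary.PropositionalEquality using (_≡_)
open import Relation.Nullary using (¬_)

InZ : ℕ → ℕ → Set
InZ m x = 1 ≤ x × x ≤ m

-- x mod m : the element of {1,…,m} congruent to x
_modZ_ : ℕ → (m : ℕ) → .{{NonZero m}} → ℕ
(x modZ m) with x % m
... | zero  = m
... | suc r = suc r

_≡[_]_ : ℕ → (m : ℕ) → .{{NonZero m}} → ℕ → Set
(x ≡[ m ] y) = x % m ≡ y % m

Idem : (m : ℕ) → .{{NonZero m}} → ℕ → Set
Idem m e = InZ m e × ((e * e) ≡[ m ] e)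

IndexOf : (m : ℕ) → .{{NonZero m}} → ℕ → ℕ → Set
IndexOf m a i =
  1 ≤ i × Idem m ((a ^ i) modZ m) × (∀ j → 1 ≤ j → j < i → ¬ Idem m ((a ^ j) modZ m))

Regular : (m : ℕ) → .{{NonZero m}} → ℕ → Set
Regular m a = InZ m a × ∃[ i ] (IndexOf m a i × ((a ^ (i + 1)) ≡[ m ] a))

InOrb : (m : ℕ) → .{{NonZero m}} → ℕ → ℕ → Set
InOrb m c x = ∃[ i ] (IndexOf m c i × ∃[ n ] (1 ≤ n × n ≤ i × x ≡ (c ^ n) modZ m))

module Submission where

-- Idea.  Since c is regular, a residue lies in Orb_m(c) exactly when it is
-- congruent to SOME positive power of c (exponents beyond |c|_m wrap around,
-- because c^(t+1) ≡ c with t = |c|_m).  Hence the set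
--   S = { e : b^e is congruent to a positive power of c }
-- is closed under addition (c^a · c^a' = c^(a+a')), and, as b is regular with
-- t = |b|_m, it is t-periodic on positive exponents: b^(e + q t) ≡ b^e.
-- The theorem is then a fact about such sets of exponents:
--   * an additive S contains every positive multiple of its elements, which
--     gives "⇐" since n and k are multiples of (n,k);
--   * an additive, t-periodic S contains gcd p q whenever it contains p and q:
--     writing d + y q = x p (Bézout), x p + (y (t-1)) q ≡ d + (y q) t, and the
--     left side lies in S while periodicity strips the (y q) t.  This is "⇒".

open import Defs
open import Data.Nat using (ℕ; zero; suc; _+_; _*_; _^_; _≤_; _<_; NonZero; z≤n; s≤s; >-nonZero)
open import Data.Nat.Properties
  using (suc-injective; ≤-trans; m≤m+n; +-identityʳ; *-identityˡ; *-comm; ^-distribˡ-+-*; n>0⇒n≢0; n≢0⇒n>0)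
open import Data.Nat.DivMod using (_%_; _/_; %-distribˡ-*; n%n≡0; m<n⇒m%n≡m; m%n<n; m≡m%n+[m/n]*n)
open import Data.Nat.Divisibility using (_∣_; divides)
open import Data.Nat.GCD using (gcd; gcd-GCD; gcd[m,n]∣m; gcd[m,n]∣n; gcd[m,n]≢0; module Bézout)
open import Data.Product using (_×_; _,_; proj₁; ∃-syntax)
open import Data.Sum using (inj₁)
open import Function.Bundles using (_⇔_; mk⇔; Equivalence)
open import Relation.Binary.PropositionalEquality
open import Data.Nat.Solver using (module +-*-Solver)
open +-*-Solver using (solve; _:=_; _:+_; _:*_; con)

gcd-positive : ∀ {n} k → 1 ≤ n → 1 ≤ gcd n k
gcd-positive {n} k hn = n≢0⇒n>0 (gcd[m,n]≢0 n k (inj₁ (n>0⇒n≢0 hn)))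

module AdditiveExponents (S : ℕ → Set) (S-+ : ∀ {p q} → S p → S q → S (p + q)) where

  S-multiple : ∀ u {e} → S e → S (suc u * e)
  S-multiple zero    {e} s = subst S (sym (*-identityˡ e)) s
  S-multiple (suc u) {e} s = S-+ s (S-multiple u s)

  S-combination : ∀ {p q} u v → S p → S q → S (suc u * p + v * q)
  S-combination {p} u zero    sp sq = subst S (sym (+-identityʳ (suc u * p))) (S-multiple u sp)
  S-combination     u (suc v) sp sq = S-+ (S-multiple u sp) (S-multiple v sq)

  S-∣ : ∀ {d n} → 1 ≤ n → d ∣ n → S d → S n
  S-∣ hn (divides zero    refl) s with () ← hn
  S-∣ hn (divides (suc u) refl) s = S-multiple u s

  -- If moreover S is periodic with period t ≥ 1 on positive exponents, then
  -- S is closed under gcd.  The period absorbs the negative Bézout coefficient.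
  module Periodic (t' : ℕ) (S-period : ∀ {e} q → 1 ≤ e → S (e + q * suc t') → S e) where

    S-bézout : ∀ {p q d} x y → S p → S q → 1 ≤ d → d + y * q ≡ x * p → S d
    S-bézout zero y sp sq (s≤s z≤n) ()
    S-bézout {p} {q} {d} (suc u) y sp sq hd eq =
      S-period (y * q) hd (subst S shift (S-combination u (y * t') sp sq))
      where
        shift : suc u * p + (y * t') * q ≡ d + (y * q) * suc t'
        shift = begin
            suc u * p + (y * t') * q
          ≡⟨ cong (_+ (y * t') * q) (sym eq) ⟩
            d + y * q + (y * t') * q
          ≡⟨ solve 4 (λ d y q t → d :+ y :* q :+ (y :* t) :* q := d :+ (y :* q) :* (con 1 :+ t)) refl d y q t' ⟩
            d + (y * q) * suc t'
          ∎
          where open ≡-Reasoning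

    S-gcd : ∀ {p q} → S p → S q → 1 ≤ gcd p q → S (gcd p q)
    S-gcd {p} {q} sp sq hd with Bézout.identity (gcd-GCD p q)
    ... | Bézout.+- x y eq = S-bézout x y sp sq hd eq
    ... | Bézout.-+ x y eq = S-bézout y x sq sp hd eq

module Modulus (m : ℕ) .{{_ : NonZero m}} where

  ≡-* : ∀ {a b c d} → a ≡[ m ] b → c ≡[ m ] d → (a * c) ≡[ m ] (b * d)
  ≡-* {a} {b} {c} {d} p q = begin
      (a * c) % m             ≡⟨ %-distribˡ-* a c m ⟩
      ((a % m) * (c % m)) % m ≡⟨ cong₂ (λ u v → (u * v) % m) p q ⟩
      ((b % m) * (d % m)) % m ≡⟨ %-distribˡ-* b d m ⟨
      (b * d) % m             ∎
    where open ≡-Reasoning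

  modZ-% : ∀ x → (x modZ m) % m ≡ x % m
  modZ-% x with x % m in eq
  ... | zero  = n%n≡0 m
  ... | suc r = m<n⇒m%n≡m (subst (_< m) eq (m%n<n x m))

  modZ-cong : ∀ {x y} → x ≡[ m ] y → x modZ m ≡ y modZ m
  modZ-cong {x} {y} p with x % m | y % m
  ... | zero  | zero  = refl
  ... | suc r | suc s = cong suc (suc-injective p)

  module Periodicity (x t : ℕ) (x-period : (x ^ (t + 1)) ≡[ m ] x) where

    ^-period : ∀ j → 1 ≤ j → (x ^ (j + t)) ≡[ m ] (x ^ j)
    ^-period (suc j) _ = begin
        x ^ (suc j + t) % m     ≡⟨ cong (λ e → x ^ e % m) (solve 2 (λ j t → con 1 :+ j :+ t := j :+ (t :+ con 1)) refl j t) ⟩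
        x ^ (j + (t + 1)) % m   ≡⟨ cong (_% m) (^-distribˡ-+-* x j (t + 1)) ⟩
        (x ^ j * x ^ (t + 1)) % m ≡⟨ ≡-* {x ^ j} refl x-period ⟩
        (x ^ j * x) % m         ≡⟨ cong (_% m) (*-comm (x ^ j) x) ⟩
        x ^ suc j % m           ∎
      where open ≡-Reasoning

    ^-periods : ∀ j q → 1 ≤ j → (x ^ (j + q * t)) ≡[ m ] (x ^ j)
    ^-periods j zero    _  = cong (λ e → x ^ e % m) (+-identityʳ j)
    ^-periods j (suc q) hj = begin
        x ^ (j + (t + q * t)) % m ≡⟨ cong (λ e → x ^ e % m) (solve 3 (λ j q t → j :+ (t :+ q :* t) := (j :+ q :* t) :+ t) refl j q t) ⟩
        x ^ (j + q * t + t) % m   ≡⟨ ^-period (j + q * t) (≤-trans hj (m≤m+n j (q * t))) ⟩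
        x ^ (j + q * t) % m       ≡⟨ ^-periods j q hj ⟩
        x ^ j % m                 ∎
      where open ≡-Reasoning

    ^-reduce : 1 ≤ t → ∀ n → 1 ≤ n → ∃[ n' ] (1 ≤ n' × n' ≤ t × (x ^ n) ≡[ m ] (x ^ n'))
    ^-reduce ht (suc n) _ = suc (n % t) , s≤s z≤n , m%n<n n t ,
      trans (cong (λ e → x ^ suc e % m) (m≡m%n+[m/n]*n n t)) (^-periods (suc (n % t)) (n / t) (s≤s z≤n))
      where instance _ : NonZero t
                     _ = >-nonZero ht

  PowerOf : ℕ → ℕ → Set
  PowerOf c y = ∃[ a ] (1 ≤ a × y ≡[ m ] (c ^ a))

  orbit⇔power : ∀ {c} y → Regular m c → InOrb m c (y modZ m) ⇔ PowerOf c y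
  orbit⇔power {c} y (_ , t , index-t , c-period) = mk⇔ to from
    where
      to : InOrb m c (y modZ m) → PowerOf c y
      to (_ , _ , a , ha , _ , eq) = a , ha , trans (sym (modZ-% y)) (trans (cong (_% m) eq) (modZ-% (c ^ a)))

      from : PowerOf c y → InOrb m c (y modZ m)
      from (a , ha , eq) with Periodicity.^-reduce c t c-period (proj₁ index-t) a ha
      ... | a' , ha' , a'≤t , eq' = t , index-t , a' , ha' , a'≤t , modZ-cong (trans eq eq')

  PowerOf-* : ∀ {c x y} → PowerOf c x → PowerOf c y → PowerOf c (x * y)
  PowerOf-* {c} (a , ha , p) (a' , _ , p') =
    a + a' , ≤-trans ha (m≤m+n a a') , trans (≡-* p p') (sym (cong (_% m) (^-distribˡ-+-* c a a')))

  PowerOf-cong : ∀ {c x y} → x ≡[ m ] y → PowerOf c x → PowerOf c y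
  PowerOf-cong e (a , ha , p) = a , ha , trans (sym e) p

  -- The exponents e for which b^e is congruent to a positive power of c.
  -- (A record, so that e can be inferred from Exponents b c e.)
  record Exponents (b c e : ℕ) : Set where
    constructor exponent
    field power : PowerOf c (b ^ e)

  Exponents-+ : ∀ {b c p q} → Exponents b c p → Exponents b c q → Exponents b c (p + q)
  Exponents-+ {b} {c} {p} {q} (exponent sp) (exponent sq) =
    exponent (subst (PowerOf c) (sym (^-distribˡ-+-* b p q)) (PowerOf-* sp sq))

  Exponents-period : ∀ {b c t'} → (b ^ (suc t' + 1)) ≡[ m ] b
    → ∀ {e} q → 1 ≤ e → Exponents b c (e + q * suc t') → Exponents b c e
  Exponents-period {b} {c} {t'} b-period q he (exponent s) =
    exponent (PowerOf-cong (Periodicity.^-periods b (suc t') b-period _ q he) s)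

proposition2p11 : (m : ℕ) → .{{_ : NonZero m}} → (b c : ℕ) → Regular m b → Regular m c
    → (n k : ℕ) → 1 ≤ n → 1 ≤ k
    → (InOrb m c ((b ^ n) modZ m) × InOrb m c ((b ^ k) modZ m)) ⇔ InOrb m c ((b ^ gcd n k) modZ m)
proposition2p11 m b c rb rc n k hn hk = mk⇔
  (λ (on , ok) → power→orbit (S-gcd-b rb {n} {k} (orbit→power on) (orbit→power ok) (gcd-positive k hn)))
  (λ o → power→orbit (S-∣ hn (gcd[m,n]∣m n k) (orbit→power o)) ,
         power→orbit (S-∣ hk (gcd[m,n]∣n n k) (orbit→power o)))
  where
    open Modulus m
    open AdditiveExponents (Exponents b c) Exponents-+

    orbit→power : ∀ {e} → InOrb m c ((b ^ e) modZ m) → Exponents b c e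
    orbit→power {e} o = exponent (Equivalence.to (orbit⇔power (b ^ e) rc) o)

    power→orbit : ∀ {e} → Exponents b c e → InOrb m c ((b ^ e) modZ m)
    power→orbit {e} (exponent s) = Equivalence.from (orbit⇔power (b ^ e) rc) s

    S-gcd-b : Regular m b → ∀ {p q} → Exponents b c p → Exponents b c q → 1 ≤ gcd p q → Exponents b c (gcd p q)
    S-gcd-b (_ , suc t' , _ , b-period) = Periodic.S-gcd t' (Exponents-period b-period)
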